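{- For every rooted tree $\tau$, $$\sum_{v\in\tau} b(v)^2\;\ge\;\sum_{v\in\tau} d(v)^2.$$
   Context: A rooted tree $\tau$ is a finite tree with a distinguished vertex $R$, the root. For a vertex $v$, $b(v)$ is the number of vertices $w$ (including $v$) such that $v$ lies on the path from $w$ to $R$. $d(v)$ is the number of vertices on the shortest path from $v$ to $R$, including both endpoints (so $d(R)=1$). -}

module Defs where

open import Data.Nat using (ℕ; suc; _+_; _*_)
open import Data.List using (List; []; _∷_)

-- Every finite rooted tree is
-- represented (up to isomorphism; the order of children is irrelevant
-- for the quantities below).
data RTree : Set where
  node : List RTree → RTree

mutual
  size : RTree → ℕ
  size (node ts) = suc (sizes ts)

  sizes : List RTree → ℕ
  sizes []       = 0
  sizes (t ∷ ts) = size t + sizes ts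

-- b(v) for a vertex v is the number of vertices of the subtree rooted at v,
-- i.e. size of that subtree.  sumB2 t = Σ_{v ∈ t} b(v)^2.
mutual
  sumB2 : RTree → ℕ
  sumB2 (node ts) = size (node ts) * size (node ts) + sumB2s ts

  sumB2s : List RTree → ℕ
  sumB2s []       = 0
  sumB2s (t ∷ ts) = sumB2 t + sumB2s ts

-- sumD2 k t = Σ_{v ∈ t} (k - 1 + depth_t(v))^2, where depth_t(root) = 1;
-- i.e. the sum of squared d-values of the vertices of t when the root of t
-- has d-value k.
mutual
  sumD2 : ℕ → RTree → ℕ
  sumD2 k (node ts) = k * k + sumD2s (suc k) ts

  sumD2s : ℕ → List RTree → ℕ
  sumD2s k []       = 0
  sumD2s k (t ∷ ts) = sumD2 k t + sumD2s k ts

sumDepth2 : RTree → ℕ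
sumDepth2 τ = sumD2 1 τ

-- With the root at depth j + 1, the depths satisfy
-- Σ (j + d(v))² = Σ d(v)² + 2j Σ d(v) + j² n, and Σ d(v) = Σ b(v), since both count
-- the ancestor–descendant pairs. Induction on the tree therefore proves
-- Σ (j + d(v))² ≤ Σ b(v)² + 2j Σ b(v) + j² n for every j; passing to the subtrees
-- below the root raises j by one, and the resulting slack in the induction step is
-- N (N + 1) − 2 Σ b(v) over the N non-root vertices, which is nonnegative because
-- a forest on N vertices has Σ b(v) ≤ N (N + 1) / 2. The theorem is the case j = 0.
module Submission where

open import Defs
open import Data.Nat using (ℕ; suc; _+_; _*_; _≤_; _≥_)
open import Data.Nat.Properties using (≤-refl; m≤m+n; +-mono-≤; +-monoʳ-≤; +-identityʳ; module ≤-Reasoning)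
open import Data.List using (List; []; _∷_)
open import Relation.Binary.PropositionalEquality using (_≡_; trans; subst)
open import Data.Nat.Tactic.RingSolver using (solve-∀)

mutual
  sumB : RTree → ℕ
  sumB (node ts) = size (node ts) + sumBs ts

  sumBs : List RTree → ℕ
  sumBs []       = 0
  sumBs (t ∷ ts) = sumB t + sumBs ts

mutual
  sumB-bound : ∀ t → 2 * sumB t ≤ size t * suc (size t)
  sumB-bound (node ts) = begin
    2 * (suc N + sumBs ts)         ≡⟨ expand N (sumBs ts) ⟩
    2 * suc N + 2 * sumBs ts       ≤⟨ +-monoʳ-≤ (2 * suc N) (sumBs-bound ts) ⟩
    2 * suc N + N * suc N          ≡⟨ collect N ⟩
    suc N * suc (suc N)            ∎
    where
    open ≤-Reasoning
    N = sizes ts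
    expand : ∀ N B → 2 * (suc N + B) ≡ 2 * suc N + 2 * B
    expand = solve-∀
    collect : ∀ N → 2 * suc N + N * suc N ≡ suc N * suc (suc N)
    collect = solve-∀

  sumBs-bound : ∀ ts → 2 * sumBs ts ≤ sizes ts * suc (sizes ts)
  sumBs-bound []       = ≤-refl
  sumBs-bound (t ∷ ts) = begin
    2 * (sumB t + sumBs ts)              ≡⟨ distrib (sumB t) (sumBs ts) ⟩
    2 * sumB t + 2 * sumBs ts            ≤⟨ +-mono-≤ (sumB-bound t) (sumBs-bound ts) ⟩
    n * suc n + m * suc m                ≤⟨ m≤m+n _ (2 * n * m) ⟩
    n * suc n + m * suc m + 2 * n * m    ≡⟨ square n m ⟩
    (n + m) * suc (n + m)                ∎
    where
    open ≤-Reasoning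
    n = size t
    m = sizes ts
    distrib : ∀ b c → 2 * (b + c) ≡ 2 * b + 2 * c
    distrib = solve-∀
    square : ∀ n m → n * suc n + m * suc m + 2 * n * m ≡ (n + m) * suc (n + m)
    square = solve-∀

mutual
  sumD2-bound : ∀ j t → sumD2 (suc j) t ≤ sumB2 t + j * j * size t + 2 * j * sumB t
  sumD2-bound j (node ts) = begin
    suc j * suc j + sumD2s (suc (suc j)) ts
      ≤⟨ +-monoʳ-≤ (suc j * suc j) (sumD2s-bound (suc j) ts) ⟩
    suc j * suc j + (B2 + suc j * suc j * N + 2 * suc j * B)
      ≡⟨ regroup j N B B2 ⟩
    B2 + j * j * suc N + 2 * j * (suc N + B) + suc N + 2 * B
      ≤⟨ +-monoʳ-≤ (B2 + j * j * suc N + 2 * j * (suc N + B) + suc N) (sumBs-bound ts) ⟩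
    B2 + j * j * suc N + 2 * j * (suc N + B) + suc N + N * suc N
      ≡⟨ complete j N B B2 ⟩
    suc N * suc N + B2 + j * j * suc N + 2 * j * (suc N + B)
      ∎
    where
    open ≤-Reasoning
    N  = sizes ts
    B  = sumBs ts
    B2 = sumB2s ts
    regroup : ∀ j N B B2 → suc j * suc j + (B2 + suc j * suc j * N + 2 * suc j * B)
              ≡ B2 + j * j * suc N + 2 * j * (suc N + B) + suc N + 2 * B
    regroup = solve-∀
    complete : ∀ j N B B2 → B2 + j * j * suc N + 2 * j * (suc N + B) + suc N + N * suc N
               ≡ suc N * suc N + B2 + j * j * suc N + 2 * j * (suc N + B)
    complete = solve-∀

  sumD2s-bound : ∀ j ts → sumD2s (suc j) ts ≤ sumB2s ts + j * j * sizes ts + 2 * j * sumBs ts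
  sumD2s-bound j []       = subst (0 ≤_) (vanish j) ≤-refl
    where
    vanish : ∀ j → 0 ≡ 0 + j * j * 0 + 2 * j * 0
    vanish = solve-∀
  sumD2s-bound j (t ∷ ts) = begin
    sumD2 (suc j) t + sumD2s (suc j) ts
      ≤⟨ +-mono-≤ (sumD2-bound j t) (sumD2s-bound j ts) ⟩
    (sumB2 t + j * j * size t + 2 * j * sumB t) + (sumB2s ts + j * j * sizes ts + 2 * j * sumBs ts)
      ≡⟨ merge j (sumB2 t) (size t) (sumB t) (sumB2s ts) (sizes ts) (sumBs ts) ⟩
    sumB2 t + sumB2s ts + j * j * (size t + sizes ts) + 2 * j * (sumB t + sumBs ts)
      ∎
    where
    open ≤-Reasoning
    merge : ∀ j a n b a′ n′ b′ → (a + j * j * n + 2 * j * b) + (a′ + j * j * n′ + 2 * j * b′)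
            ≡ a + a′ + j * j * (n + n′) + 2 * j * (b + b′)
    merge = solve-∀

corollary2p3 : (τ : RTree) → sumB2 τ ≥ sumDepth2 τ
corollary2p3 τ = subst (sumDepth2 τ ≤_) dropZeros (sumD2-bound 0 τ)
  where
  dropZeros : sumB2 τ + 0 + 0 ≡ sumB2 τ
  dropZeros = trans (+-identityʳ _) (+-identityʳ _)
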